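{- Let $p, q, f \in \mathbb{C}[x]$ be polynomials with $p$ and $q$ non-constant and $f$ non-zero. Then every $(n,m) \in \mathbb{N}^2$ with $p^n - q^m = f$ satisfies $$\max\{n,m\} \leq \frac{1 + \deg p + \deg q + 2\deg f}{\min\{\deg p, \deg q\}}.$$
   Context: $\mathbb{N}$ denotes the set of positive integers. -}

module Defs where

open import Level using (Level; _⊔_)
open import Data.Nat as ℕ using (ℕ; zero; suc; _≤_; _<_)
open import Data.Product using (Σ; ∃; _×_; _,_)
open import Relation.Nullary using (¬_)
open import Algebra.Bundles using (CommutativeRing)

-- Polynomials over a commutative ring R, represented by their coefficient
-- sequences ℕ → Carrier (coefficient of x^i at index i). All polynomials occurring
-- in the statement have a degree (hence finite support) by hypothesis.
module Poly {c ℓ : Level} (R : CommutativeRing c ℓ) where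
  open CommutativeRing R using (Carrier; _≈_; _+_; _*_; _-_; 0#; 1#)

  Pol : Set c
  Pol = ℕ → Carrier

  sumTo : ℕ → (ℕ → Carrier) → Carrier
  sumTo zero    g = g zero
  sumTo (suc k) g = sumTo k g + g (suc k)

  oneP : Pol
  oneP zero    = 1#
  oneP (suc _) = 0#

  _-P_ : Pol → Pol → Pol
  (p -P q) k = p k - q k

  _*P_ : Pol → Pol → Pol
  (p *P q) k = sumTo k (λ i → p i * q (k ℕ.∸ i))

  _^P_ : Pol → ℕ → Pol
  p ^P zero  = oneP
  p ^P suc n = p *P (p ^P n)

  _≈P_ : Pol → Pol → Set ℓ
  p ≈P q = ∀ k → p k ≈ q k

  -- p has degree d: the coefficient of x^d is non-zero and all higher
  -- coefficients vanish. (The zero polynomial has no degree.)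
  HasDegree : Pol → ℕ → Set ℓ
  HasDegree p d = (¬ (p d ≈ 0#)) × (∀ k → d < k → p k ≈ 0#)

  evalUpTo : ℕ → Pol → Carrier → Carrier
  evalUpTo d p x = sumTo d (λ i → p i * (x ^ i))
    where
    _^_ : Carrier → ℕ → Carrier
    y ^ zero  = 1#
    y ^ suc n = y * (y ^ n)

  natCast : ℕ → Carrier
  natCast zero    = 0#
  natCast (suc n) = 1# + natCast n

IsField : {c ℓ : Level} → CommutativeRing c ℓ → Set (c ⊔ ℓ)
IsField R = (¬ (1# ≈ 0#)) × (∀ x → ¬ (x ≈ 0#) → Σ Carrier λ y → x * y ≈ 1#)
  where open CommutativeRing R using (Carrier; _≈_; _+_; _*_; _-_; 0#; 1#)

CharZero : {c ℓ : Level} → CommutativeRing c ℓ → Set ℓ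
CharZero R = ∀ n → ¬ (natCast (suc n) ≈ 0#)
  where open CommutativeRing R using (Carrier; _≈_; _+_; _*_; _-_; 0#; 1#)
        open Poly R

AlgClosed : {c ℓ : Level} → CommutativeRing c ℓ → Set (c ⊔ ℓ)
AlgClosed R = ∀ (p : Pol) (d : ℕ) → HasDegree p d → 1 ≤ d →
              Σ Carrier λ x → evalUpTo d p x ≈ 0#
  where open CommutativeRing R using (Carrier; _≈_; _+_; _*_; _-_; 0#; 1#)
        open Poly R

module Submission where

-- With D₁ = n·deg p and D₂ = m·deg q we prove the sharper bound
--   max (n·deg p) (m·deg q) ≤ deg p + deg q + deg f,
-- from which the stated one follows since (n ⊔ m)·(deg p ⊓ deg q) ≤ D₁ ⊔ D₂.
-- If D₁ ≠ D₂, the leading terms of p^n and q^m cannot cancel, so D₁ ⊔ D₂ ≤ deg f.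
-- If D₁ = D₂ = D, we use the Euler operator E = x·d/dx (a derivation on K[x]).
-- Differentiating f = P - Q with P = p^n, Q = q^m and using p·E P = n·E p·P
-- gives the Wronskian-type identity
--   W := n·E p·q·f - p·q·E f  =  Q·h,   h := m·p·E q - n·E p·q.
-- W has degree ≤ T = deg p + deg q + deg f with coefficient (n·deg p - deg f)·lc
-- at x^T, non-zero in characteristic zero when deg f < D; then h ≠ 0 and Q·h has
-- a non-zero coefficient at degree ≥ D, forcing D ≤ T.

open import Defs
open import Level using (Level)
open import Algebra.Bundles using (CommutativeRing)
import Data.Nat as ℕ
open ℕ using (ℕ; zero; suc; z≤n; s≤s; _≤_; _<_)
import Data.Nat.Properties as ℕP
open import Data.Product using (_×_; _,_; proj₁; proj₂)
open import Data.Sum using (inj₁; inj₂)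
open import Relation.Binary.Definitions using (tri<; tri≈; tri>)
open import Data.Empty using (⊥-elim)
open import Relation.Nullary using (¬_; yes; no)
import Relation.Binary.PropositionalEquality as ≡
open ≡ using (_≡_)
import Relation.Binary.Reasoning.Setoid as SetoidReasoning
import Algebra.Construct.Pointwise as Pointwise
import Algebra.Properties.Ring as RingProperties
import Algebra.Solver.Ring.NaturalCoefficients.Default as NatSolver

module CommutativeRingFacts {c ℓ : Level} (R : CommutativeRing c ℓ) where
  open CommutativeRing R
  open RingProperties ring public
  open Poly R using (natCast)
  open SetoidReasoning setoid
  open NatSolver commutativeSemiring

  -- Rearrangements involving negation (the natural-coefficient ring solver
  -- treats -_ as an atom, so these are derived by hand).
  x-0≈x : ∀ x → x - 0# ≈ x
  x-0≈x x = trans (+-congˡ -0#≈0#) (+-identityʳ x)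

  -x≈0⇒x≈0 : ∀ x → - x ≈ 0# → x ≈ 0#
  -x≈0⇒x≈0 x e = -‿injective (trans e (sym -0#≈0#))

  [x+y]-x≈y : ∀ x y → (x + y) - x ≈ y
  [x+y]-x≈y x y = begin
    (x + y) - x   ≈⟨ solve 3 (λ x y x' → (x :+ y) :+ x' := y :+ (x :+ x')) refl x y (- x) ⟩
    y + (x - x)   ≈⟨ +-congˡ (-‿inverseʳ x) ⟩
    y + 0#        ≈⟨ +-identityʳ y ⟩
    y             ∎

  [x-y]-[x-z]≈z-y : ∀ x y z → (x - y) - (x - z) ≈ z - y
  [x-y]-[x-z]≈z-y x y z = begin
    (x - y) - (x - z)        ≈⟨ +-congˡ (-‿+-comm x (- z)) ⟨
    (x - y) + (- x - - z)    ≈⟨ +-congˡ (+-congˡ (-‿involutive z)) ⟩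
    (x - y) + (- x + z)      ≈⟨ solve 4 (λ x y' x' z → (x :+ y') :+ (x' :+ z) := (x :+ x') :+ (z :+ y')) refl x (- y) (- x) z ⟩
    (x - x) + (z - y)        ≈⟨ +-congʳ (-‿inverseʳ x) ⟩
    0# + (z - y)             ≈⟨ +-identityˡ _ ⟩
    z - y                    ∎

  -- The algebraic heart of the equal-degree case: if f = P - Q, E f = E P - E Q,
  -- p·E P = N·(e·P) and q·E Q = M·(e'·Q), then the combination
  -- N·e·q·f - p·q·E f is divisible by Q.  (Stated for arbitrary ring elements;
  -- it is used in the polynomial ring with e = E p, e' = E q.)
  wronskian-identity : ∀ N M e e' p q P Q f Ef EP EQ →
    f ≈ P - Q → Ef ≈ EP - EQ → p * EP ≈ N * (e * P) → q * EQ ≈ M * (e' * Q) →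
    (N * (e * q)) * f - (p * q) * Ef ≈ Q * (M * (p * e') - N * (e * q))
  wronskian-identity N M e e' p q P Q f Ef EP EQ hf hEf hp hq = begin
    c₁ * f - (p * q) * Ef                             ≈⟨ +-cong (*-congˡ hf) (-‿cong (*-congˡ hEf)) ⟩
    c₁ * (P - Q) - (p * q) * (EP - EQ)                ≈⟨ +-cong (x[y-z]≈xy-xz c₁ P Q) (-‿cong (x[y-z]≈xy-xz _ EP EQ)) ⟩
    (c₁ * P - c₁ * Q) - ((p * q) * EP - (p * q) * EQ) ≈⟨ +-congˡ (-‿cong (+-cong pqEP (-‿cong pqEQ))) ⟩
    (c₁ * P - c₁ * Q) - (c₁ * P - p * (M * (e' * Q))) ≈⟨ [x-y]-[x-z]≈z-y _ _ _ ⟩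
    p * (M * (e' * Q)) - c₁ * Q                       ≈⟨ +-cong (solve 4 (λ p M e' Q → p :* (M :* (e' :* Q)) := Q :* (M :* (p :* e'))) refl p M e' Q) (-‿cong (*-comm c₁ Q)) ⟩
    Q * (M * (p * e')) - Q * c₁                       ≈⟨ x[y-z]≈xy-xz Q _ _ ⟨
    Q * (M * (p * e') - c₁)                           ∎
    where
    c₁ = N * (e * q)
    pqEP : (p * q) * EP ≈ c₁ * P
    pqEP = begin
      (p * q) * EP        ≈⟨ solve 3 (λ p q EP → (p :* q) :* EP := q :* (p :* EP)) refl p q EP ⟩
      q * (p * EP)        ≈⟨ *-congˡ hp ⟩
      q * (N * (e * P))   ≈⟨ solve 4 (λ q N e P → q :* (N :* (e :* P)) := (N :* (e :* q)) :* P) refl q N e P ⟩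
      c₁ * P              ∎
    pqEQ : (p * q) * EQ ≈ p * (M * (e' * Q))
    pqEQ = trans (*-assoc p q EQ) (*-congˡ hq)

  natCast-+ : ∀ a b → natCast (a ℕ.+ b) ≈ natCast a + natCast b
  natCast-+ zero    b = sym (+-identityˡ _)
  natCast-+ (suc a) b = trans (+-congˡ (natCast-+ a b)) (sym (+-assoc _ _ _))

  natCast-* : ∀ a b → natCast (a ℕ.* b) ≈ natCast a * natCast b
  natCast-* zero    b = sym (zeroˡ _)
  natCast-* (suc a) b = begin
    natCast (b ℕ.+ a ℕ.* b)            ≈⟨ natCast-+ b (a ℕ.* b) ⟩
    natCast b + natCast (a ℕ.* b)      ≈⟨ +-congˡ (natCast-* a b) ⟩
    natCast b + natCast a * natCast b  ≈⟨ solve 2 (λ x y → y :+ x :* y := (con 1 :+ x) :* y) refl (natCast a) (natCast b) ⟩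
    (1# + natCast a) * natCast b       ∎

  -- In characteristic zero the canonical map ℕ → R is injective: if a ≤ b and
  -- natCast a ≈ natCast b then natCast (b ∸ a) ≈ 0, so b ∸ a must vanish.
  natCast-injective-≤ : CharZero R → ∀ {a b} → a ≤ b → natCast a ≈ natCast b → a ≡ b
  natCast-injective-≤ cz {a} {b} a≤b e with b ℕ.∸ a in b∸a
  ... | zero  = ℕP.≤-antisym a≤b (ℕP.m∸n≡0⇒m≤n b∸a)
  ... | suc j = ⊥-elim (cz j (begin
    natCast (suc j)                           ≡⟨ ≡.cong natCast b∸a ⟨
    natCast (b ℕ.∸ a)                         ≈⟨ [x+y]-x≈y (natCast a) _ ⟨
    natCast a + natCast (b ℕ.∸ a) - natCast a ≈⟨ +-congʳ (natCast-+ a (b ℕ.∸ a)) ⟨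
    natCast (a ℕ.+ (b ℕ.∸ a)) - natCast a       ≡⟨ ≡.cong (λ t → natCast t - natCast a) (ℕP.m+[n∸m]≡n a≤b) ⟩
    natCast b - natCast a                     ≈⟨ x≈y⇒x∙y⁻¹≈ε (sym e) ⟩
    0#                                        ∎))

  natCast-injective : CharZero R → ∀ {a b} → natCast a ≈ natCast b → a ≡ b
  natCast-injective cz {a} {b} e with ℕP.≤-total a b
  ... | inj₁ a≤b = natCast-injective-≤ cz a≤b e
  ... | inj₂ b≤a = ≡.sym (natCast-injective-≤ cz b≤a (sym e))

module FieldFacts {c ℓ : Level} (R : CommutativeRing c ℓ) (field' : IsField R) where
  open CommutativeRing R
  open import Algebra.Properties.Semiring.Exp semiring using (_^_)
  open SetoidReasoning setoid
  open NatSolver commutativeSemiring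

  *-nonzero : ∀ x y → ¬ (x ≈ 0#) → ¬ (y ≈ 0#) → ¬ (x * y ≈ 0#)
  *-nonzero x y x≉0 y≉0 xy≈0 = y≉0 (begin
    y                ≈⟨ *-identityˡ y ⟨
    1# * y           ≈⟨ *-congʳ x*x⁻¹≈1 ⟨
    (x * x⁻¹) * y    ≈⟨ solve 3 (λ x x' y → (x :* x') :* y := x' :* (x :* y)) refl x x⁻¹ y ⟩
    x⁻¹ * (x * y)    ≈⟨ *-congˡ xy≈0 ⟩
    x⁻¹ * 0#         ≈⟨ zeroʳ x⁻¹ ⟩
    0#               ∎)
    where
    x⁻¹ = proj₁ (proj₂ field' x x≉0)
    x*x⁻¹≈1 = proj₂ (proj₂ field' x x≉0)

  ^-nonzero : ∀ x n → ¬ (x ≈ 0#) → ¬ (x ^ n ≈ 0#)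
  ^-nonzero x zero    x≉0 = proj₁ field'
  ^-nonzero x (suc n) x≉0 = *-nonzero x (x ^ n) x≉0 (^-nonzero x n x≉0)

module Polynomials {c ℓ : Level} (K : CommutativeRing c ℓ) where
  open CommutativeRing K
  open Poly K
  open CommutativeRingFacts K
  open import Algebra.Properties.Semiring.Exp semiring using (_^_)
  open SetoidReasoning setoid
  open NatSolver commutativeSemiring

  sumTo-cong : ∀ k {g h : ℕ → Carrier} → (∀ i → i ≤ k → g i ≈ h i) → sumTo k g ≈ sumTo k h
  sumTo-cong zero    e = e 0 z≤n
  sumTo-cong (suc k) e = +-cong (sumTo-cong k (λ i i≤k → e i (ℕP.m≤n⇒m≤1+n i≤k))) (e (suc k) ℕP.≤-refl)

  sumTo-+ : ∀ k (g h : ℕ → Carrier) → sumTo k (λ i → g i + h i) ≈ sumTo k g + sumTo k h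
  sumTo-+ zero    g h = refl
  sumTo-+ (suc k) g h = trans (+-congʳ (sumTo-+ k g h))
    (solve 4 (λ a b x y → (a :+ b) :+ (x :+ y) := (a :+ x) :+ (b :+ y)) refl _ _ _ _)

  sumTo-* : ∀ k a (g : ℕ → Carrier) → sumTo k (λ i → a * g i) ≈ a * sumTo k g
  sumTo-* zero    a g = refl
  sumTo-* (suc k) a g = trans (+-congʳ (sumTo-* k a g)) (sym (distribˡ a _ _))

  sumTo-zero : ∀ k (g : ℕ → Carrier) → (∀ i → i ≤ k → g i ≈ 0#) → sumTo k g ≈ 0#
  sumTo-zero k g e = trans (sumTo-cong k e) (sumTo-0 k)
    where
    sumTo-0 : ∀ k → sumTo k (λ _ → 0#) ≈ 0#
    sumTo-0 zero    = refl
    sumTo-0 (suc k) = trans (+-congʳ (sumTo-0 k)) (+-identityˡ 0#)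

  sumTo-split : ∀ k (g : ℕ → Carrier) → sumTo (suc k) g ≈ g 0 + sumTo k (λ i → g (suc i))
  sumTo-split zero    g = refl
  sumTo-split (suc k) g = trans (+-congʳ (sumTo-split k g)) (+-assoc _ _ _)

  tail : Pol → Pol
  tail p k = p (suc k)

  0P : Pol
  0P _ = 0#

  _+P_ : Pol → Pol → Pol
  (p +P q) k = p k + q k

  -P_ : Pol → Pol
  (-P p) k = - p k

  Cst : Carrier → Pol
  Cst a zero    = a
  Cst a (suc _) = 0#

  *P-suc : ∀ p q k → (p *P q) (suc k) ≈ p 0 * q (suc k) + (tail p *P q) k
  *P-suc p q k = sumTo-split k _

  *P-sucʳ : ∀ k p q → (p *P q) (suc k) ≈ (p *P tail q) k + p (suc k) * q 0
  *P-sucʳ zero    p q = refl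
  *P-sucʳ (suc k) p q = begin
    (p *P q) (suc (suc k))                                                ≈⟨ *P-suc p q (suc k) ⟩
    p 0 * q (suc (suc k)) + (tail p *P q) (suc k)                         ≈⟨ +-congˡ (*P-sucʳ k (tail p) q) ⟩
    p 0 * q (suc (suc k)) + ((tail p *P tail q) k + p (suc (suc k)) * q 0) ≈⟨ +-assoc _ _ _ ⟨
    (p 0 * q (suc (suc k)) + (tail p *P tail q) k) + p (suc (suc k)) * q 0 ≈⟨ +-congʳ (*P-suc p (tail q) k) ⟨
    (p *P tail q) (suc k) + p (suc (suc k)) * q 0                          ∎

  *P-cong : ∀ {p p' q q'} → p ≈P p' → q ≈P q' → (p *P q) ≈P (p' *P q')
  *P-cong e₁ e₂ k = sumTo-cong k (λ i _ → *-cong (e₁ i) (e₂ _))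

  *P-congˡ : ∀ p {q q'} → q ≈P q' → (p *P q) ≈P (p *P q')
  *P-congˡ p {q} {q'} q≈q' = *P-cong {p} {p} {q} {q'} (λ _ → refl) q≈q'

  *P-congʳ : ∀ q {p p'} → p ≈P p' → (p *P q) ≈P (p' *P q)
  *P-congʳ q {p} {p'} p≈p' = *P-cong {p} {p'} {q} {q} p≈p' (λ _ → refl)

  *P-zeroˡ : ∀ p q → p ≈P 0P → (p *P q) ≈P 0P
  *P-zeroˡ p q e k = sumTo-zero k _ (λ i _ → trans (*-congʳ (e i)) (zeroˡ _))

  *P-zeroʳ : ∀ p q → q ≈P 0P → (p *P q) ≈P 0P
  *P-zeroʳ p q e k = sumTo-zero k _ (λ i _ → trans (*-congˡ (e _)) (zeroʳ _))

  *P-comm : ∀ k p q → (p *P q) k ≈ (q *P p) k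
  *P-comm zero    p q = *-comm _ _
  *P-comm (suc k) p q = begin
    (p *P q) (suc k)                     ≈⟨ *P-suc p q k ⟩
    p 0 * q (suc k) + (tail p *P q) k    ≈⟨ +-congˡ (*P-comm k (tail p) q) ⟩
    p 0 * q (suc k) + (q *P tail p) k    ≈⟨ trans (+-comm _ _) (+-congˡ (*-comm _ _)) ⟩
    (q *P tail p) k + q (suc k) * p 0    ≈⟨ *P-sucʳ k q p ⟨
    (q *P p) (suc k)                     ∎

  *P-scaleˡ : ∀ k a p q → ((λ i → a * p i) *P q) k ≈ a * (p *P q) k
  *P-scaleˡ k a p q = trans (sumTo-cong k (λ i _ → *-assoc _ _ _)) (sumTo-* k a _)

  *P-distribʳ : ∀ k p q r → ((p +P q) *P r) k ≈ (p *P r) k + (q *P r) k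
  *P-distribʳ k p q r = trans (sumTo-cong k (λ i _ → distribʳ _ _ _)) (sumTo-+ k _ _)

  *P-distribˡ : ∀ k p q r → (p *P (q +P r)) k ≈ (p *P q) k + (p *P r) k
  *P-distribˡ k p q r = begin
    (p *P (q +P r)) k          ≈⟨ *P-comm k p _ ⟩
    ((q +P r) *P p) k          ≈⟨ *P-distribʳ k q r p ⟩
    (q *P p) k + (r *P p) k    ≈⟨ +-cong (*P-comm k q p) (*P-comm k r p) ⟩
    (p *P q) k + (p *P r) k    ∎

  *P-assoc : ∀ k p q r → ((p *P q) *P r) k ≈ (p *P (q *P r)) k
  *P-assoc zero    p q r = *-assoc _ _ _
  *P-assoc (suc k) p q r = begin
    ((p *P q) *P r) (suc k)
      ≈⟨ *P-suc (p *P q) r k ⟩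
    (p 0 * q 0) * r (suc k) + (tail (p *P q) *P r) k
      ≈⟨ +-congˡ (*P-congʳ r (*P-suc p q) k) ⟩
    (p 0 * q 0) * r (suc k) + (((λ j → p 0 * tail q j) +P (tail p *P q)) *P r) k
      ≈⟨ +-congˡ (*P-distribʳ k _ _ r) ⟩
    (p 0 * q 0) * r (suc k) + (((λ j → p 0 * tail q j) *P r) k + ((tail p *P q) *P r) k)
      ≈⟨ +-congˡ (+-cong (*P-scaleˡ k (p 0) (tail q) r) (*P-assoc k (tail p) q r)) ⟩
    (p 0 * q 0) * r (suc k) + (p 0 * (tail q *P r) k + (tail p *P (q *P r)) k)
      ≈⟨ solve 5 (λ a b x y z → (a :* b) :* x :+ (a :* y :+ z) := a :* (b :* x :+ y) :+ z) refl (p 0) (q 0) (r (suc k)) _ _ ⟩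
    p 0 * (q 0 * r (suc k) + (tail q *P r) k) + (tail p *P (q *P r)) k
      ≈⟨ +-congʳ (*-congˡ (*P-suc q r k)) ⟨
    p 0 * (q *P r) (suc k) + (tail p *P (q *P r)) k
      ≈⟨ *P-suc p (q *P r) k ⟨
    (p *P (q *P r)) (suc k) ∎

  *P-identityˡ : ∀ k p → (oneP *P p) k ≈ p k
  *P-identityˡ zero    p = *-identityˡ _
  *P-identityˡ (suc k) p = begin
    (oneP *P p) (suc k)                        ≈⟨ *P-suc oneP p k ⟩
    1# * p (suc k) + (tail oneP *P p) k        ≈⟨ +-cong (*-identityˡ _) (*P-zeroˡ (tail oneP) p (λ _ → refl) k) ⟩
    p (suc k) + 0#                             ≈⟨ +-identityʳ _ ⟩
    p (suc k)                                  ∎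

  -- K[x] is a commutative ring; this lets the ring solver and the identities of
  -- CommutativeRingFacts be applied to polynomials.
  polynomialRing : CommutativeRing c ℓ
  polynomialRing = record
    { Carrier = Pol ; _≈_ = _≈P_ ; _+_ = _+P_ ; _*_ = _*P_ ; -_ = -P_ ; 0# = 0P ; 1# = oneP
    ; isCommutativeRing = record
      { isRing = record
        { +-isAbelianGroup = Pointwise.isAbelianGroup ℕ +-isAbelianGroup
        ; *-cong = *P-cong
        ; *-assoc = λ p q r k → *P-assoc k p q r
        ; *-identity = (λ p k → *P-identityˡ k p) , (λ p k → trans (*P-comm k p oneP) (*P-identityˡ k p))
        ; distrib = (λ p q r k → *P-distribˡ k p q r) , (λ p q r k → *P-distribʳ k q r p)
        }
      ; *-comm = λ p q k → *P-comm k p q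
      }
    }

  DegreeAtMost : Pol → ℕ → Set ℓ
  DegreeAtMost p a = ∀ k → a < k → p k ≈ 0#

  *P-degree : ∀ a b p q → DegreeAtMost p a → DegreeAtMost q b →
              DegreeAtMost (p *P q) (a ℕ.+ b) × ((p *P q) (a ℕ.+ b) ≈ p a * q b)
  *P-degree zero b p q p≤0 q≤b = bound , top
    where
    tail-p≈0 : tail p ≈P 0P
    tail-p≈0 i = p≤0 (suc i) (s≤s z≤n)
    bound : DegreeAtMost (p *P q) b
    bound (suc k) b<k = begin
      (p *P q) (suc k)                     ≈⟨ *P-suc p q k ⟩
      p 0 * q (suc k) + (tail p *P q) k    ≈⟨ +-cong (trans (*-congˡ (q≤b (suc k) b<k)) (zeroʳ _)) (*P-zeroˡ (tail p) q tail-p≈0 k) ⟩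
      0# + 0#                              ≈⟨ +-identityˡ 0# ⟩
      0#                                   ∎
    top : (p *P q) b ≈ p 0 * q b
    top = constant-times b
      where
      constant-times : ∀ b → (p *P q) b ≈ p 0 * q b
      constant-times zero    = refl
      constant-times (suc b) = begin
        (p *P q) (suc b)                     ≈⟨ *P-suc p q b ⟩
        p 0 * q (suc b) + (tail p *P q) b    ≈⟨ +-congˡ (*P-zeroˡ (tail p) q tail-p≈0 b) ⟩
        p 0 * q (suc b) + 0#                 ≈⟨ +-identityʳ _ ⟩
        p 0 * q (suc b)                      ∎
  *P-degree (suc a) b p q p≤a q≤b = bound , top
    where
    IH = *P-degree a b (tail p) q (λ k a<k → p≤a (suc k) (s≤s a<k)) q≤b
    q-high : ∀ k → a ℕ.+ b < k → q (suc k) ≈ 0#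
    q-high k lt = q≤b (suc k) (s≤s (ℕP.≤-trans (ℕP.m≤n+m b a) (ℕP.<⇒≤ lt)))
    bound : DegreeAtMost (p *P q) (suc (a ℕ.+ b))
    bound (suc k) (s≤s lt) = begin
      (p *P q) (suc k)                     ≈⟨ *P-suc p q k ⟩
      p 0 * q (suc k) + (tail p *P q) k    ≈⟨ +-cong (trans (*-congˡ (q-high k lt)) (zeroʳ _)) (proj₁ IH k lt) ⟩
      0# + 0#                              ≈⟨ +-identityˡ 0# ⟩
      0#                                   ∎
    top : (p *P q) (suc (a ℕ.+ b)) ≈ p (suc a) * q b
    top = begin
      (p *P q) (suc (a ℕ.+ b))                         ≈⟨ *P-suc p q (a ℕ.+ b) ⟩
      p 0 * q (suc (a ℕ.+ b)) + (tail p *P q) (a ℕ.+ b) ≈⟨ +-cong (trans (*-congˡ (q≤b _ (s≤s (ℕP.m≤n+m b a)))) (zeroʳ _)) (proj₂ IH) ⟩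
      0# + p (suc a) * q b                             ≈⟨ +-identityˡ _ ⟩
      p (suc a) * q b                                  ∎

  ^P-degree : ∀ n a p → DegreeAtMost p a →
              DegreeAtMost (p ^P n) (n ℕ.* a) × ((p ^P n) (n ℕ.* a) ≈ p a ^ n)
  ^P-degree zero    a p p≤a = (λ { (suc k) _ → refl }) , refl
  ^P-degree (suc n) a p p≤a =
    let (bound , top)   = ^P-degree n a p p≤a
        (bound′ , top′) = *P-degree a (n ℕ.* a) p (p ^P n) p≤a bound
    in bound′ , trans top′ (*-congˡ top)

  Cst-degree : ∀ a → DegreeAtMost (Cst a) 0
  Cst-degree a (suc k) _ = refl

  -P-degree : ∀ p q a → DegreeAtMost p a → DegreeAtMost q a → DegreeAtMost (p -P q) a
  -P-degree p q a p≤a q≤a k lt = trans (+-cong (p≤a k lt) (-‿cong (q≤a k lt))) (x-0≈x 0#)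

  nonzero⇒≤degree : ∀ f d k → DegreeAtMost f d → ¬ (f k ≈ 0#) → k ≤ d
  nonzero⇒≤degree f d k f≤d fk≉0 with k ℕ.≤? d
  ... | yes k≤d = k≤d
  ... | no  k≰d = ⊥-elim (fk≉0 (f≤d k (ℕP.≰⇒> k≰d)))

  -- A polynomial of bounded degree that is not identically zero cannot lack a
  -- leading coefficient: one of its non-zero coefficients has only zeros above it.
  -- (Stated negatively, as the search for it is not constructive.)
  leading-coefficient : ∀ B h → DegreeAtMost h B → ¬ (h ≈P 0P) →
                        ¬ (∀ k → ¬ (h k ≈ 0#) → ¬ DegreeAtMost h k)
  leading-coefficient zero h h≤0 h≉0 no-top =
    no-top 0 (λ h₀≈0 → h≉0 (λ { zero → h₀≈0 ; (suc i) → h≤0 (suc i) (s≤s z≤n) })) h≤0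
  leading-coefficient (suc B) h h≤B h≉0 no-top =
    no-top (suc B) (λ h-top≈0 → leading-coefficient B h (lower h-top≈0) h≉0 no-top) h≤B
    where
    lower : h (suc B) ≈ 0# → DegreeAtMost h B
    lower h-top≈0 k B<k with ℕP.m≤n⇒m<n∨m≡n B<k
    ... | inj₁ B+1<k = h≤B k B+1<k
    ... | inj₂ ≡.refl = h-top≈0

  -- The Euler operator E = x·d/dx: (E p)_k = k·p_k. It is a derivation.

  E : Pol → Pol
  E p k = natCast k * p k

  E-degree : ∀ p a → DegreeAtMost p a → DegreeAtMost (E p) a
  E-degree p a p≤a k lt = trans (*-congˡ (p≤a k lt)) (zeroʳ _)

  E-cong : ∀ {p q} → p ≈P q → E p ≈P E q
  E-cong e k = *-congˡ (e k)

  E--P : ∀ p q → E (p -P q) ≈P (E p -P E q)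
  E--P p q k = x[y-z]≈xy-xz _ _ _

  E-one : E oneP ≈P 0P
  E-one zero    = zeroˡ _
  E-one (suc k) = zeroʳ _

  -- Leibniz rule, coefficientwise: k = i + (k ∸ i) in each term of the product.
  E-leibniz : ∀ p q → E (p *P q) ≈P ((E p *P q) +P (p *P E q))
  E-leibniz p q k = begin
    natCast k * sumTo k (λ i → p i * q (k ℕ.∸ i))           ≈⟨ sumTo-* k _ _ ⟨
    sumTo k (λ i → natCast k * (p i * q (k ℕ.∸ i)))         ≈⟨ sumTo-cong k split-index ⟩
    sumTo k (λ i → E p i * q (k ℕ.∸ i) + p i * E q (k ℕ.∸ i)) ≈⟨ sumTo-+ k _ _ ⟩
    ((E p *P q) +P (p *P E q)) k                             ∎
    where
    split-index : ∀ i → i ≤ k →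
      natCast k * (p i * q (k ℕ.∸ i)) ≈ E p i * q (k ℕ.∸ i) + p i * E q (k ℕ.∸ i)
    split-index i i≤k = begin
      natCast k * (p i * q j)                  ≡⟨ ≡.cong (λ t → natCast t * (p i * q j)) (ℕP.m+[n∸m]≡n i≤k) ⟨
      natCast (i ℕ.+ j) * (p i * q j)          ≈⟨ *-congʳ (natCast-+ i j) ⟩
      (natCast i + natCast j) * (p i * q j)    ≈⟨ solve 4 (λ a b x y → (a :+ b) :* (x :* y) := (a :* x) :* y :+ x :* (b :* y)) refl (natCast i) (natCast j) (p i) (q j) ⟩
      E p i * q j + p i * E q j                ∎
      where j = k ℕ.∸ i

  Cst-+ : ∀ a b → Cst (a + b) ≈P (Cst a +P Cst b)
  Cst-+ a b zero    = refl
  Cst-+ a b (suc k) = sym (+-identityˡ 0#)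

  Cst-1 : Cst 1# ≈P oneP
  Cst-1 zero    = refl
  Cst-1 (suc k) = refl

  Cst-0 : Cst 0# ≈P 0P
  Cst-0 zero    = refl
  Cst-0 (suc k) = refl

  module K[x] where
    open CommutativeRing polynomialRing public
    open CommutativeRingFacts polynomialRing public
    open SetoidReasoning (CommutativeRing.setoid polynomialRing) public
    open NatSolver (CommutativeRing.commutativeSemiring polynomialRing) public

  E-power : ∀ p n → (p *P E (p ^P n)) ≈P (Cst (natCast n) *P (E p *P (p ^P n)))
  E-power p zero = K[x].begin
    p *P E oneP                   K[x].≈⟨ *P-congˡ p E-one ⟩
    p *P 0P                       K[x].≈⟨ K[x].zeroʳ p ⟩
    0P                            K[x].≈⟨ K[x].zeroˡ (E p *P oneP) ⟨
    0P *P (E p *P oneP)           K[x].≈⟨ *P-congʳ (E p *P oneP) Cst-0 ⟨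
    Cst 0# *P (E p *P oneP)       K[x].∎
  E-power p (suc n) = K[x].begin
    p *P E (p *P pⁿ)
      K[x].≈⟨ *P-congˡ p (E-leibniz p pⁿ) ⟩
    p *P ((E p *P pⁿ) +P (p *P E pⁿ))
      K[x].≈⟨ K[x].distribˡ p (E p *P pⁿ) (p *P E pⁿ) ⟩
    (p *P (E p *P pⁿ)) +P (p *P (p *P E pⁿ))
      K[x].≈⟨ (λ k → +-congˡ (*P-congˡ p (E-power p n) k)) ⟩
    (p *P (E p *P pⁿ)) +P (p *P (n̂ *P (E p *P pⁿ)))
      K[x].≈⟨ K[x].solve 4 (λ x C y z → x K[x].:* (y K[x].:* z) K[x].:+ x K[x].:* (C K[x].:* (y K[x].:* z))
                            K[x].:= (K[x].con 1 K[x].:+ C) K[x].:* (y K[x].:* (x K[x].:* z))) K[x].refl p n̂ (E p) pⁿ ⟩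
    (oneP +P n̂) *P (E p *P (p *P pⁿ))
      K[x].≈⟨ *P-congʳ (E p *P (p *P pⁿ)) one+n̂ ⟩
    Cst (natCast (suc n)) *P (E p *P (p *P pⁿ)) K[x].∎
    where
    pⁿ = p ^P n
    n̂ = Cst (natCast n)
    one+n̂ : (oneP +P n̂) ≈P Cst (natCast (suc n))
    one+n̂ k = trans (+-congʳ (sym (Cst-1 k))) (sym (Cst-+ 1# (natCast n) k))

  W : Carrier → Pol → Pol → Pol → Pol
  W N p q f = ((Cst N *P (E p *P q)) *P f) -P ((p *P q) *P E f)

  cofactor : Carrier → Carrier → Pol → Pol → Pol
  cofactor N M p q = (Cst M *P (p *P E q)) -P (Cst N *P (E p *P q))

  W-factorisation : ∀ p q f n m → ((p ^P n) -P (q ^P m)) ≈P f →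
    W (natCast n) p q f ≈P ((q ^P m) *P cofactor (natCast n) (natCast m) p q)
  W-factorisation p q f n m pⁿ-qᵐ≈f =
    K[x].wronskian-identity (Cst (natCast n)) (Cst (natCast m)) (E p) (E q) p q
      (p ^P n) (q ^P m) f (E f) (E (p ^P n)) (E (q ^P m))
      (λ k → sym (pⁿ-qᵐ≈f k))
      (λ k → trans (E-cong (λ i → sym (pⁿ-qᵐ≈f i)) k) (E--P (p ^P n) (q ^P m) k))
      (E-power p n) (E-power q m)

  -- W has degree at most dp + dq + df, with coefficient
  -- (N·dp - df)·p_dp·q_dq·f_df there (E acts on a top coefficient as
  -- multiplication by the degree).
  W-degree : ∀ N p q f dp dq df →
    DegreeAtMost p dp → DegreeAtMost q dq → DegreeAtMost f df →
    DegreeAtMost (W N p q f) (dp ℕ.+ dq ℕ.+ df) ×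
    (W N p q f (dp ℕ.+ dq ℕ.+ df) ≈ (N * natCast dp - natCast df) * ((p dp * q dq) * f df))
  W-degree N p q f dp dq df p≤dp q≤dq f≤df =
    -P-degree _ _ T (proj₁ left) (proj₁ right) , top
    where
    T = dp ℕ.+ dq ℕ.+ df
    Ep*q  = *P-degree dp dq (E p) q (E-degree p dp p≤dp) q≤dq
    N*Ep*q = *P-degree 0 (dp ℕ.+ dq) (Cst N) (E p *P q) (Cst-degree N) (proj₁ Ep*q)
    left  = *P-degree (dp ℕ.+ dq) df (Cst N *P (E p *P q)) f (proj₁ N*Ep*q) f≤df
    p*q   = *P-degree dp dq p q p≤dp q≤dq
    right = *P-degree (dp ℕ.+ dq) df (p *P q) (E f) (proj₁ p*q) (E-degree f df f≤df)
    a = p dp ; b = q dq ; e = f df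
    top : W N p q f T ≈ (N * natCast dp - natCast df) * ((a * b) * e)
    top = begin
      W N p q f T
        ≈⟨ +-cong (trans (proj₂ left) (*-congʳ (trans (proj₂ N*Ep*q) (*-congˡ (proj₂ Ep*q)))))
                  (-‿cong (trans (proj₂ right) (*-congʳ (proj₂ p*q)))) ⟩
      (N * ((natCast dp * a) * b)) * e - (a * b) * (natCast df * e)
        ≈⟨ +-cong (solve 5 (λ N d a b e → (N :* ((d :* a) :* b)) :* e := (N :* d) :* ((a :* b) :* e)) refl N (natCast dp) a b e)
                  (-‿cong (solve 4 (λ a b d e → (a :* b) :* (d :* e) := d :* ((a :* b) :* e)) refl a b (natCast df) e)) ⟩
      (N * natCast dp) * ((a * b) * e) - natCast df * ((a * b) * e)
        ≈⟨ [y-z]x≈yx-zx _ _ _ ⟨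
      (N * natCast dp - natCast df) * ((a * b) * e) ∎

  cofactor-degree : ∀ N M p q dp dq → DegreeAtMost p dp → DegreeAtMost q dq →
    DegreeAtMost (cofactor N M p q) (dp ℕ.+ dq)
  cofactor-degree N M p q dp dq p≤dp q≤dq = -P-degree _ _ (dp ℕ.+ dq)
    (proj₁ (*P-degree 0 _ (Cst M) _ (Cst-degree M) (proj₁ (*P-degree dp dq p (E q) p≤dp (E-degree q dq q≤dq)))))
    (proj₁ (*P-degree 0 _ (Cst N) _ (Cst-degree N) (proj₁ (*P-degree dp dq (E p) q (E-degree p dp p≤dp) q≤dq))))

  leading-term-survivesʳ : ∀ P Q f a b df → DegreeAtMost P a → ¬ (Q b ≈ 0#) → a < b →
    (P -P Q) ≈P f → DegreeAtMost f df → b ≤ df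
  leading-term-survivesʳ P Q f a b df P≤a Qb≉0 a<b P-Q≈f f≤df =
    nonzero⇒≤degree f df b f≤df (λ fb≈0 → Qb≉0 (-x≈0⇒x≈0 (Q b) (begin
      - Q b           ≈⟨ +-identityˡ (- Q b) ⟨
      0# - Q b        ≈⟨ +-congʳ (P≤a b a<b) ⟨
      P b - Q b       ≈⟨ P-Q≈f b ⟩
      f b             ≈⟨ fb≈0 ⟩
      0#              ∎)))

  leading-term-survivesˡ : ∀ P Q f a b df → DegreeAtMost Q b → ¬ (P a ≈ 0#) → b < a →
    (P -P Q) ≈P f → DegreeAtMost f df → a ≤ df
  leading-term-survivesˡ P Q f a b df Q≤b Pa≉0 b<a P-Q≈f f≤df =
    nonzero⇒≤degree f df a f≤df (λ fa≈0 → Pa≉0 (begin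
      P a             ≈⟨ x-0≈x (P a) ⟨
      P a - 0#        ≈⟨ +-congˡ (-‿cong (Q≤b a b<a)) ⟨
      P a - Q a       ≈⟨ P-Q≈f a ⟩
      f a             ≈⟨ fa≈0 ⟩
      0#              ∎))

  module OverAField (field' : IsField K) where
    open FieldFacts K field'

    -- If Q has exact degree D and h ≠ 0, then Q·h has a non-zero coefficient
    -- at some index ≥ D (namely D + deg h).
    product-degree-lower-bound : ∀ D B Q h → DegreeAtMost Q D → ¬ (Q D ≈ 0#) →
      DegreeAtMost h B → ¬ (h ≈P 0P) → ¬ (∀ k → D ≤ k → (Q *P h) k ≈ 0#)
    product-degree-lower-bound D B Q h Q≤D QD≉0 h≤B h≉0 Qh-high≈0 =
      leading-coefficient B h h≤B h≉0 λ k hk≉0 h≤k →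
        *-nonzero (Q D) (h k) QD≉0 hk≉0
          (trans (sym (proj₂ (*P-degree D k Q h Q≤D h≤k))) (Qh-high≈0 (D ℕ.+ k) (ℕP.m≤m+n D k)))

    ^P-leading : ∀ p d n → HasDegree p d → ¬ ((p ^P n) (n ℕ.* d) ≈ 0#)
    ^P-leading p d n (pd≉0 , p≤d) e = ^-nonzero (p d) n pd≉0 (trans (sym (proj₂ (^P-degree n d p p≤d))) e)

    equal-degrees : CharZero K → ∀ p q f dp dq df n m →
      HasDegree p dp → HasDegree q dq → HasDegree f df →
      ((p ^P n) -P (q ^P m)) ≈P f → n ℕ.* dp ≡ m ℕ.* dq → m ℕ.* dq ≤ dp ℕ.+ dq ℕ.+ df
    equal-degrees cz p q f dp dq df n m (pd≉0 , p≤dp) hq@(qd≉0 , q≤dq) (fd≉0 , f≤df) pⁿ-qᵐ≈f nd≡md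
      with m ℕ.* dq ℕ.≤? dp ℕ.+ dq ℕ.+ df
    ... | yes D≤T = D≤T
    ... | no  D≰T = ⊥-elim (product-degree-lower-bound (m ℕ.* dq) (dp ℕ.+ dq) (q ^P m) h
                      (proj₁ (^P-degree m dq q q≤dq)) (^P-leading q dq m hq) (cofactor-degree _ _ p q dp dq p≤dp q≤dq) h≉0 qᵐh-high≈0)
      where
      T = dp ℕ.+ dq ℕ.+ df
      T<D = ℕP.≰⇒> D≰T
      h = cofactor (natCast n) (natCast m) p q
      W-bounds = W-degree (natCast n) p q f dp dq df p≤dp q≤dq f≤df
      W≈qᵐh = W-factorisation p q f n m pⁿ-qᵐ≈f
      -- n·dp ≠ df, since df ≤ T < D = n·dp; hence the top coefficient of W is non-zero.
      n·dp≉df : ¬ (natCast n * natCast dp - natCast df ≈ 0#)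
      n·dp≉df e = ℕP.<-irrefl (≡.sym n·dp≡df)
        (ℕP.≤-<-trans (ℕP.m≤n+m df (dp ℕ.+ dq)) (≡.subst (T <_) (≡.sym nd≡md) T<D))
        where
        n·dp≡df : n ℕ.* dp ≡ df
        n·dp≡df = natCast-injective cz (trans (natCast-* n dp) (x∙y⁻¹≈ε⇒x≈y _ _ e))
      W-top≉0 : ¬ (W (natCast n) p q f T ≈ 0#)
      W-top≉0 e = *-nonzero _ _ n·dp≉df (*-nonzero _ _ (*-nonzero _ _ pd≉0 qd≉0) fd≉0)
        (trans (sym (proj₂ W-bounds)) e)
      h≉0 : ¬ (h ≈P 0P)
      h≉0 h≈0 = W-top≉0 (trans (W≈qᵐh T) (*P-zeroʳ (q ^P m) h h≈0 T))
      qᵐh-high≈0 : ∀ k → m ℕ.* dq ≤ k → ((q ^P m) *P h) k ≈ 0#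
      qᵐh-high≈0 k D≤k = trans (sym (W≈qᵐh k)) (proj₁ W-bounds k (ℕP.<-≤-trans T<D D≤k))

    max-degree-bound : CharZero K → ∀ p q f dp dq df n m →
      HasDegree p dp → HasDegree q dq → HasDegree f df →
      ((p ^P n) -P (q ^P m)) ≈P f → n ℕ.* dp ℕ.⊔ m ℕ.* dq ≤ dp ℕ.+ dq ℕ.+ df
    max-degree-bound cz p q f dp dq df n m hp hq hf@(_ , f≤df) pⁿ-qᵐ≈f
      with ℕP.<-cmp (n ℕ.* dp) (m ℕ.* dq)
    ... | tri< lt _ _ = ℕP.⊔-lub (ℕP.≤-trans (ℕP.<⇒≤ lt) m·dq≤T) m·dq≤T
      where
      m·dq≤T = ℕP.≤-trans
        (leading-term-survivesʳ (p ^P n) (q ^P m) f _ _ df (proj₁ (^P-degree n dp p (proj₂ hp)))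
           (^P-leading q dq m hq) lt pⁿ-qᵐ≈f f≤df)
        (ℕP.m≤n+m df (dp ℕ.+ dq))
    ... | tri≈ _ eq _ = ℕP.⊔-lub (≡.subst (_≤ dp ℕ.+ dq ℕ.+ df) (≡.sym eq) m·dq≤T) m·dq≤T
      where
      m·dq≤T = equal-degrees cz p q f dp dq df n m hp hq hf pⁿ-qᵐ≈f eq
    ... | tri> _ _ gt = ℕP.⊔-lub n·dp≤T (ℕP.≤-trans (ℕP.<⇒≤ gt) n·dp≤T)
      where
      n·dp≤T = ℕP.≤-trans
        (leading-term-survivesˡ (p ^P n) (q ^P m) f _ _ df (proj₁ (^P-degree m dq q (proj₂ hq)))
           (^P-leading p dp n hp) gt pⁿ-qᵐ≈f f≤df)
        (ℕP.m≤n+m df (dp ℕ.+ dq))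

open import Data.Nat using (_+_; _*_; _⊔_; _⊓_)
open ℕP.≤-Reasoning

max*min≤max-of-products : ∀ n m a b → (n ⊔ m) * (a ⊓ b) ≤ n * a ⊔ m * b
max*min≤max-of-products n m a b = begin
  (n ⊔ m) * (a ⊓ b)             ≡⟨ ℕP.*-distribʳ-⊔ (a ⊓ b) n m ⟩
  n * (a ⊓ b) ⊔ m * (a ⊓ b)     ≤⟨ ℕP.⊔-mono-≤ (ℕP.*-monoʳ-≤ n (ℕP.m⊓n≤m a b)) (ℕP.*-monoʳ-≤ m (ℕP.m⊓n≤n a b)) ⟩
  n * a ⊔ m * b                 ∎

corollary2 : {c ℓ : Level} (K : CommutativeRing c ℓ) →
    IsField K → CharZero K → AlgClosed K →
    let open Poly K in
    (p q f : Pol) (dp dq df : ℕ) →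
    HasDegree p dp → HasDegree q dq → HasDegree f df →
    1 ≤ dp → 1 ≤ dq →
    (n m : ℕ) → 1 ≤ n → 1 ≤ m →
    ((p ^P n) -P (q ^P m)) ≈P f →
    (n ⊔ m) * (dp ⊓ dq) ≤ 1 + dp + dq + 2 * df
corollary2 K field' cz _ p q f dp dq df hp hq hf _ _ n m _ _ pⁿ-qᵐ≈f = begin
  (n ⊔ m) * (dp ⊓ dq)     ≤⟨ max*min≤max-of-products n m dp dq ⟩
  n * dp ⊔ m * dq         ≤⟨ Polynomials.OverAField.max-degree-bound K field' cz p q f dp dq df n m hp hq hf pⁿ-qᵐ≈f ⟩
  dp + dq + df            ≤⟨ ℕP.+-monoʳ-≤ (dp + dq) (ℕP.m≤m+n df (df + 0)) ⟩
  dp + dq + 2 * df        ≤⟨ ℕP.n≤1+n _ ⟩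
  1 + dp + dq + 2 * df    ∎
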